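{- Let $\tau$ be a chain-complete tree set and $\sigma\subseteq\tau$ a star with exactly three elements. Then there is a unique branching star $\sigma'$ of $\tau$ such that every element of $\sigma$ lies below a different element of $\sigma'$.
   Context: A separation system is a poset $(\vec S,\le)$ with an order-reversing involution $\vec s\mapsto\overleftarrow s$; $s=\{\vec s,\overleftarrow s\}$ is the unoriented separation. Unoriented $r,s$ are nested if some orientation of $r$ is $\le$ some orientation of $s$. $\vec s$ is degenerate if $\vec s=\overleftarrow s$; $\vec r$ is trivial if there is $s$ with $\vec r<\vec s$ and $\vec r<\overleftarrow s$ (strictly). A tree set is a separation system in which any two separations are nested and which has no degenerate and no trivial elements. It is chain-complete if every non-empty chain has a supremum in it. A star is a set $\sigma$ of oriented separations with $\vec r\le\overleftarrow s$ for all distinct $\vec r,\vec s\in\sigma$. An orientation is a set $O$ containing exactly one orientation of every unoriented separation; it is consistent if there are no $\vec r,\vec s\in O$ with $r\ne s$ and $\overleftarrow r\le\vec s$. $\sigma$ is a splitting star of $\tau$ if $\tau$ has a consistent orientation $O$ such that every element of $O$ lies below some element of $\sigma$ and $\sigma$ is the set of maximal elements of $O$. A branching star is a splitting star with at least three elements. -}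

module Defs where

open import Level using (0ℓ)
open import Data.Product using (Σ; ∃; _×_; _,_; proj₁)
open import Data.Sum using (_⊎_)
open import Data.Empty using (⊥)
open import Relation.Nullary using (¬_)
open import Relation.Binary.PropositionalEquality using (_≡_; _≢_)
open import Relation.Binary.Structures using (IsPartialOrder)
open import Function.Bundles using (_⇔_)

record SeparationSystem : Set₁ where
  infix 4 _≤_ _<_
  infix 10 _*
  field
    S              : Set
    _≤_            : S → S → Set
    isPartialOrder : IsPartialOrder _≡_ _≤_
    _*             : S → S
    involutive     : ∀ x → (x *) * ≡ x
    order-reversing : ∀ {x y} → x ≤ y → y * ≤ x *

  _<_ : S → S → Set
  x < y = x ≤ y × x ≢ y

  Pred : Set₁
  Pred = S → Set

  -- the unoriented separations of r and s are nested
  Nested : S → S → Set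
  Nested r s = (r ≤ s) ⊎ (r ≤ s *) ⊎ (r * ≤ s) ⊎ (r * ≤ s *)

  Degenerate : S → Set
  Degenerate s = s ≡ s *

  Trivial : S → Set
  Trivial r = ∃ λ s → (r < s) × (r < s *)

  -- r and s have different underlying unoriented separations
  DifferentSep : S → S → Set
  DifferentSep r s = r ≢ s × r ≢ s *

  IsTreeSet : Set
  IsTreeSet = (∀ r s → Nested r s) × (∀ s → ¬ Degenerate s) × (∀ s → ¬ Trivial s)

  IsChain : Pred → Set
  IsChain C = ∀ x y → C x → C y → (x ≤ y) ⊎ (y ≤ x)

  IsSupremum : Pred → S → Set
  IsSupremum C m = (∀ x → C x → x ≤ m) × (∀ u → (∀ x → C x → x ≤ u) → m ≤ u)

  ChainComplete : Set₁
  ChainComplete = ∀ (C : Pred) → IsChain C → (∃ λ x → C x) → ∃ λ m → IsSupremum C m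

  IsStar : Pred → Set
  IsStar σ = ∀ r s → σ r → σ s → r ≢ s → r ≤ s *

  IsOrientation : Pred → Set
  IsOrientation O = ∀ s → (O s ⊎ O (s *)) × ¬ (O s × O (s *))

  IsConsistent : Pred → Set
  IsConsistent O = ∀ r s → O r → O s → DifferentSep r s → ¬ (r * ≤ s)

  IsMaximalSetOf : Pred → Pred → Set
  IsMaximalSetOf σ O = ∀ x → σ x ⇔ (O x × (∀ y → O y → x ≤ y → y ≡ x))

  IsSplittingStar : Pred → Set₁
  IsSplittingStar σ =
    IsStar σ ×
    Σ Pred λ O → IsOrientation O × IsConsistent O
               × (∀ x → O x → ∃ λ y → σ y × x ≤ y)
               × IsMaximalSetOf σ O

  AtLeastThree : Pred → Set
  AtLeastThree σ = ∃ λ a → ∃ λ b → ∃ λ c →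
    σ a × σ b × σ c × a ≢ b × a ≢ c × b ≢ c

  ExactlyThree : Pred → Set
  ExactlyThree σ = ∃ λ a → ∃ λ b → ∃ λ c →
    a ≢ b × a ≢ c × b ≢ c × (∀ x → σ x ⇔ ((x ≡ a) ⊎ (x ≡ b) ⊎ (x ≡ c)))

  IsBranchingStar : Pred → Set₁
  IsBranchingStar σ = IsSplittingStar σ × AtLeastThree σ

  -- every element of σ lies below a different element of σ'
  -- (an injective assignment of elements of σ' above the elements of σ)
  LiesBelowDistinct : Pred → Pred → Set
  LiesBelowDistinct σ σ' =
    Σ ((x : S) → σ x → S) λ f →
      (∀ x (p : σ x) → σ' (f x p) × x ≤ f x p)
      × (∀ x y (p : σ x) (q : σ y) → f x p ≡ f y q → x ≡ y)

  SamePred : Pred → Pred → Set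
  SamePred σ σ' = ∀ x → σ x ⇔ σ' x

module Submission where

-- Write the three-element star σ as w₀, w₁, w₂.  The region of an index i is
-- the set of separations x with wᵢ ≤ x ≤ wⱼ* for both j ≠ i.  In a tree set a
-- region is strongly consistent and bounded below by wᵢ, hence a chain, so by
-- chain-completeness it has a greatest element vᵢ.  Points of different regions
-- always form a star, so v is again a three-star, and it is saturated: vᵢ is the
-- only point of its own region.  For a saturated three-star v, the separations
-- lying below some vᵢ or pointing away from all of them form a consistent
-- orientation O of τ; its maximal elements form a splitting star σ' containing
-- every vᵢ, so σ' is branching and wᵢ ≤ vᵢ ∈ σ'.  Conversely, if σ lies below
-- distinct elements uᵢ of a splitting star σ'', then uᵢ lies in the region of i,
-- so uᵢ ≤ vᵢ; this forces vᵢ = uᵢ ∈ σ'', then σ'' ⊆ O, and so the orientation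
-- of σ'' is O and σ'' = σ'.  That O orients every s is seen by comparing s with
-- each vᵢ: if neither s nor s* lies below some vᵢ, then either s or s* points
-- away from all vᵢ, or it lies above exactly one vᵢ and equals it by saturation.

open import Defs
open import Level using (0ℓ)
open import Data.Product using (Σ; _×_; _,_; proj₁; proj₂; ∃)
open import Data.Sum using (_⊎_; inj₁; inj₂)
open import Data.Empty using (⊥; ⊥-elim)
open import Data.Fin using (Fin; zero; suc; _≟_)
open import Data.Fin.Properties using (∀-cons; 0≢1+n)
open import Function using (id)
open import Relation.Nullary using (¬_; yes; no)
open import Relation.Binary.PropositionalEquality using (_≡_; _≢_; refl; sym; trans; cong; subst; subst₂)
open import Relation.Binary.Structures using (IsPartialOrder)
open import Function.Bundles using (mk⇔; Equivalence)
open import Axiom.ExcludedMiddle using (ExcludedMiddle)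

other : (i j : Fin 3) → Σ (Fin 3) λ k → k ≢ i × k ≢ j
other zero             zero             = suc zero       , (λ ()) , (λ ())
other zero             (suc zero)       = suc (suc zero) , (λ ()) , (λ ())
other zero             (suc (suc zero)) = suc zero       , (λ ()) , (λ ())
other (suc zero)       zero             = suc (suc zero) , (λ ()) , (λ ())
other (suc zero)       (suc zero)       = zero           , (λ ()) , (λ ())
other (suc zero)       (suc (suc zero)) = zero           , (λ ()) , (λ ())
other (suc (suc zero)) zero             = suc zero       , (λ ()) , (λ ())
other (suc (suc zero)) (suc zero)       = zero           , (λ ()) , (λ ())
other (suc (suc zero)) (suc (suc zero)) = zero           , (λ ()) , (λ ())

next : Fin 3 → Fin 3
next zero             = suc zero
next (suc zero)       = suc (suc zero)
next (suc (suc zero)) = zero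

except : {P : Fin 3 → Set} (i : Fin 3) → P (next i) → P (next (next i)) → ∀ {j} → j ≢ i → P j
except zero             p q {zero}             i≢i = ⊥-elim (i≢i refl)
except zero             p q {suc zero}         _   = p
except zero             p q {suc (suc zero)}   _   = q
except (suc zero)       p q {zero}             _   = q
except (suc zero)       p q {suc zero}         i≢i = ⊥-elim (i≢i refl)
except (suc zero)       p q {suc (suc zero)}   _   = p
except (suc (suc zero)) p q {zero}             _   = p
except (suc (suc zero)) p q {suc zero}         _   = q
except (suc (suc zero)) p q {suc (suc zero)}   i≢i = ⊥-elim (i≢i refl)

every : {P : Fin 3 → Set} → P zero → P (suc zero) → P (suc (suc zero)) → ∀ i → P i
every p q r = ∀-cons p (∀-cons q (∀-cons r λ ()))

module TreeSets (em : ExcludedMiddle 0ℓ) (τ : SeparationSystem)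
                (tree : SeparationSystem.IsTreeSet τ)
                (complete : SeparationSystem.ChainComplete τ) where
  open SeparationSystem τ
  open IsPartialOrder isPartialOrder using (antisym; reflexive)
    renaming (refl to ≤-refl; trans to ≤-trans)

  ≤*-sym : ∀ {x y} → x ≤ y * → y ≤ x *
  ≤*-sym {x} {y} p = subst (_≤ x *) (involutive y) (order-reversing p)

  *≤-sym : ∀ {x y} → x * ≤ y → y * ≤ x
  *≤-sym {x} {y} p = subst (y * ≤_) (involutive x) (order-reversing p)

  *≤*-reverse : ∀ {x y} → x * ≤ y * → y ≤ x
  *≤*-reverse {x} {y} p = subst₂ _≤_ (involutive y) (involutive x) (order-reversing p)

  *-swap : ∀ {x y} → x ≡ y * → x * ≡ y
  *-swap {x} {y} e = trans (cong _* e) (involutive y)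

  nested : ∀ r s → Nested r s
  nested = proj₁ tree

  below-both : ∀ {x y} → x ≤ y → x ≤ y * → x ≡ y ⊎ x ≡ y *
  below-both {x} {y} x≤y x≤y* with em {x ≡ y} | em {x ≡ y *}
  ... | yes x≡y | _        = inj₁ x≡y
  ... | no _    | yes x≡y* = inj₂ x≡y*
  ... | no x≢y  | no x≢y*  = ⊥-elim (proj₂ (proj₂ tree) x (y , (x≤y , x≢y) , (x≤y* , x≢y*)))

  StronglyConsistent : Pred → Set
  StronglyConsistent A = ∀ {x y} → A x → A y → ¬ (x * ≤ y)

  SupClosed : Pred → Set₁
  SupClosed A = ∀ C {m} → (∀ {y} → C y → A y) → (∃ λ y → C y) → IsSupremum C m → A m

  MaximalIn : Pred → Pred
  MaximalIn O x = O x × (∀ y → O y → x ≤ y → y ≡ x)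

  above-chain : ∀ {A : Pred} {x : S} → StronglyConsistent A → (∀ {y} → A y → x ≤ y) → IsChain A
  above-chain {A} {x} consistent above y z ay az with nested y z
  ... | inj₁ y≤z                 = inj₁ y≤z
  ... | inj₂ (inj₂ (inj₁ y*≤z))  = ⊥-elim (consistent ay az y*≤z)
  ... | inj₂ (inj₂ (inj₂ y*≤z*)) = inj₂ (*≤*-reverse y*≤z*)
  ... | inj₂ (inj₁ y≤z*) with below-both (above az) (≤-trans (above ay) y≤z*)
  ...   | inj₁ x≡z  = inj₂ (subst (_≤ y) x≡z (above ay))
  ...   | inj₂ x≡z* = inj₁ (≤-trans (subst (y ≤_) (sym x≡z*) y≤z*) (above az))

  greatest-above : ∀ {A : Pred} {x : S} → StronglyConsistent A → SupClosed A → A x →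
                   Σ S λ m → A m × (∀ {y} → A y → x ≤ y → y ≤ m)
  greatest-above {A} {x} consistent closed ax =
    m , closed C proj₁ (x , ax , ≤-refl) m-sup , λ ay x≤y → proj₁ m-sup _ (ay , x≤y)
    where
    C : Pred
    C y = A y × x ≤ y
    chain : IsChain C
    chain = above-chain (λ cy cz → consistent (proj₁ cy) (proj₁ cz)) proj₂
    m : S
    m = proj₁ (complete C chain (x , ax , ≤-refl))
    m-sup : IsSupremum C m
    m-sup = proj₂ (complete C chain (x , ax , ≤-refl))

  consistent-pointing : ∀ {O : Pred} {r s : S} → IsOrientation O → IsConsistent O →
                        O r → O s → r * ≤ s → r ≡ s
  consistent-pointing {O} {r} {s} orient consistent or os r*≤s with em {r ≡ s} | em {r ≡ s *}
  ... | yes r≡s | _        = r≡s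
  ... | no _    | yes r≡s* = ⊥-elim (proj₂ (orient s) (os , subst O r≡s* or))
  ... | no r≢s  | no r≢s*  = ⊥-elim (consistent r s or os (r≢s , r≢s*) r*≤s)

  maximal-star : ∀ {O : Pred} → IsOrientation O → IsConsistent O → IsStar (MaximalIn O)
  maximal-star orient consistent r s (or , r-max) (os , s-max) r≢s with nested r s
  ... | inj₁ r≤s                 = ⊥-elim (r≢s (sym (r-max s os r≤s)))
  ... | inj₂ (inj₁ r≤s*)         = r≤s*
  ... | inj₂ (inj₂ (inj₁ r*≤s))  = ⊥-elim (r≢s (consistent-pointing orient consistent or os r*≤s))
  ... | inj₂ (inj₂ (inj₂ r*≤s*)) = ⊥-elim (r≢s (s-max r or (*≤*-reverse r*≤s*)))

  orientation-⊇ : ∀ {O O' : Pred} → IsOrientation O → IsOrientation O' →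
                  (∀ {x} → O' x → O x) → ∀ {x} → O x → O' x
  orientation-⊇ {O} {O'} orient orient' O'⊆O {x} ox with proj₁ (orient' x)
  ... | inj₁ o'x  = o'x
  ... | inj₂ o'x* = ⊥-elim (proj₂ (orient x) (ox , O'⊆O o'x*))

  maximal-transfer : ∀ {σ O O' : Pred} → (∀ {x} → O x → O' x) → (∀ {x} → O' x → O x) →
                     IsMaximalSetOf σ O → SamePred σ (MaximalIn O')
  maximal-transfer {σ} {O} {O'} O⊆O' O'⊆O σ-max x = mk⇔ to from
    where
    to : σ x → MaximalIn O' x
    to σx = let (ox , x-max) = Equivalence.to (σ-max x) σx
            in O⊆O' ox , λ y o'y → x-max y (O'⊆O o'y)
    from : MaximalIn O' x → σ x
    from (o'x , x-max) = Equivalence.from (σ-max x) (O'⊆O o'x , λ y oy → x-max y (O⊆O' oy))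

  record ThreeStar (w : Fin 3 → S) : Set where
    field
      star      : ∀ {i j} → i ≢ j → w i ≤ w j *
      injective : ∀ {i j} → w i ≡ w j → i ≡ j

  record Region (w : Fin 3 → S) (i : Fin 3) (x : S) : Set where
    field
      above : w i ≤ x
      away  : ∀ {j} → j ≢ i → x ≤ w j *

  region-mono : ∀ {u v : Fin 3 → S} {i x} → (∀ i → u i ≤ v i) → Region v i x → Region u i x
  region-mono u≤v r = record
    { above = ≤-trans (u≤v _) (Region.above r)
    ; away  = λ j≢i → ≤-trans (Region.away r j≢i) (order-reversing (u≤v _))
    }

  Saturated : (Fin 3 → S) → Set
  Saturated v = ∀ {i x} → Region v i x → x ≡ v i

  module ThreeStarFacts {w : Fin 3 → S} (W : ThreeStar w) where
    open ThreeStar W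

    incomparable : ∀ {i j} → w j ≤ w i → j ≡ i
    incomparable {i} {j} wj≤wi with j ≟ i
    ... | yes j≡i = j≡i
    ... | no j≢i with below-both wj≤wi (star j≢i)
    ...   | inj₁ wj≡wi  = injective wj≡wi
    ...   | inj₂ wj≡wi* =
      let (k , k≢i , k≢j) = other i j
      in ⊥-elim (third-index k≢i k≢j (below-both (subst (w k ≤_) (sym wj≡wi*) (star k≢i)) (star k≢j)))
      where
      -- a third element w k would lie below both w j and w j* = w i
      third-index : ∀ {k} → k ≢ i → k ≢ j → w k ≡ w j ⊎ w k ≡ w j * → ⊥
      third-index k≢i k≢j (inj₁ wk≡wj)  = k≢j (injective wk≡wj)
      third-index k≢i k≢j (inj₂ wk≡wj*) = k≢i (injective (trans wk≡wj* (*-swap wj≡wi*)))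

    distinct : ∀ {i j} → i ≢ j → w i ≢ w j
    distinct i≢j e = i≢j (injective e)

    no-inverse-below : ∀ {i j} → ¬ (w j * ≤ w i)
    no-inverse-below {i} {j} wj*≤wi =
      let (k , k≢i , k≢j) = other i j in k≢i (incomparable (≤-trans (star k≢j) wj*≤wi))

    own-region : ∀ i → Region w i (w i)
    own-region i = record { above = ≤-refl ; away = λ j≢i → star (λ i≡j → j≢i (sym i≡j)) }

    region-exclusive : ∀ {i k x} → Region w i x → w k ≤ x → k ≡ i
    region-exclusive {i} {k} {x} r wk≤x with k ≟ i
    ... | yes k≡i = k≡i
    ... | no k≢i with below-both wk≤x (≤*-sym (Region.away r k≢i))
    ...   | inj₁ wk≡x  = ⊥-elim (k≢i (sym (incomparable (subst (w i ≤_) (sym wk≡x) (Region.above r)))))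
    ...   | inj₂ wk≡x* =
      -- x = w k* lies below w j* for the third index j, so w j ≤ w k
      let (j , j≢i , j≢k) = other i k
      in ⊥-elim (j≢k (incomparable (*≤*-reverse (subst (_≤ w j *) (sym (*-swap wk≡x*)) (Region.away r j≢i)))))

    -- If x* ≤ y in the region of i, then x lies above some w k with k ≠ i.
    region-strongly-consistent : ∀ i → StronglyConsistent (Region w i)
    region-strongly-consistent i rx ry x*≤y =
      let (k , k≢i , _) = other i i
      in k≢i (region-exclusive rx (*≤*-reverse (≤-trans x*≤y (Region.away ry k≢i))))

    region-sup-closed : ∀ i → SupClosed (Region w i)
    region-sup-closed i C C⊆R (y , cy) (upper , least) = record
      { above = ≤-trans (Region.above (C⊆R cy)) (upper y cy)
      ; away  = λ j≢i → least _ (λ z cz → Region.away (C⊆R cz) j≢i)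
      }

    regions-star : ∀ {i j x y} → i ≢ j → Region w i x → Region w j y → x ≤ y *
    regions-star {i} {j} {x} {y} i≢j rx ry with nested x y
    ... | inj₁ x≤y                 = ⊥-elim (i≢j (region-exclusive ry (≤-trans (Region.above rx) x≤y)))
    ... | inj₂ (inj₁ x≤y*)         = x≤y*
    ... | inj₂ (inj₂ (inj₁ x*≤y))  =
      let (k , k≢i , k≢j) = other i j
      in ⊥-elim (k≢i (region-exclusive rx (*≤*-reverse (≤-trans x*≤y (Region.away ry k≢j)))))
    ... | inj₂ (inj₂ (inj₂ x*≤y*)) =
      ⊥-elim (i≢j (sym (region-exclusive rx (≤-trans (Region.above ry) (*≤*-reverse x*≤y*)))))

  module Saturation {w : Fin 3 → S} (W : ThreeStar w) where
    open ThreeStarFacts W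

    greatest : ∀ i → Σ S λ m → Region w i m × (∀ {y} → Region w i y → w i ≤ y → y ≤ m)
    greatest i = greatest-above (region-strongly-consistent i) (region-sup-closed i) (own-region i)

    v : Fin 3 → S
    v i = proj₁ (greatest i)

    v-region : ∀ i → Region w i (v i)
    v-region i = proj₁ (proj₂ (greatest i))

    v-greatest : ∀ {i y} → Region w i y → y ≤ v i
    v-greatest ry = proj₂ (proj₂ (greatest _)) ry (Region.above ry)

    w≤v : ∀ i → w i ≤ v i
    w≤v i = Region.above (v-region i)

    -- v i and v j lie in different regions, and v i lies above w i only.
    v-three-star : ThreeStar v
    v-three-star = record
      { star      = λ i≢j → regions-star i≢j (v-region _) (v-region _)
      ; injective = λ {i} {j} vi≡vj → region-exclusive (v-region j) (subst (w i ≤_) vi≡vj (w≤v i))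
      }

    -- The region of v i is part of the region of w i, whose greatest element is v i.
    v-saturated : Saturated v
    v-saturated rx = antisym (v-greatest (region-mono w≤v rx)) (Region.above rx)

  module Orientation {v : Fin 3 → S} (V : ThreeStar v) (saturated : Saturated v) where
    open ThreeStar V
    open ThreeStarFacts V

    PointsAway : Pred
    PointsAway x = ∀ i → x ≤ v i *

    O : Pred
    O x = (Σ (Fin 3) λ i → x ≤ v i) ⊎ PointsAway x

    away-region : ∀ {i x} → v i ≤ x → PointsAway x → Region v i x
    away-region vi≤x x-away = record { above = vi≤x ; away = λ _ → x-away _ }

    O-down-closed : ∀ {x y} → x ≤ y → O y → O x
    O-down-closed x≤y (inj₁ (i , y≤vi)) = inj₁ (i , ≤-trans x≤y y≤vi)
    O-down-closed x≤y (inj₂ y-away)     = inj₂ λ i → ≤-trans x≤y (y-away i)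

    -- Each case reduces to incomparability of the v i (or to saturation of their regions).
    O-strongly-consistent : StronglyConsistent O
    O-strongly-consistent (inj₁ (i , x≤vi)) (inj₁ (j , y≤vj)) x*≤y =
      no-inverse-below (≤-trans (*≤-sym (≤-trans x*≤y y≤vj)) x≤vi)
    O-strongly-consistent (inj₁ (i , x≤vi)) (inj₂ y-away) x*≤y =
      let (k , k≢i , _) = other i i
      in k≢i (incomparable (≤-trans (*≤*-reverse (≤-trans x*≤y (y-away k))) x≤vi))
    O-strongly-consistent (inj₂ x-away) (inj₁ (i , y≤vi)) x*≤y =
      let (k , k≢i , _) = other i i
      in k≢i (incomparable (*≤*-reverse (≤-trans (*≤-sym (≤-trans x*≤y y≤vi)) (x-away k))))
    O-strongly-consistent {x} (inj₂ x-away) (inj₂ y-away) x*≤y =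
      -- x would lie above both v 0 and v 1 while pointing away from all v i
      0≢1+n (region-exclusive {suc zero} {zero} (away-region (above (suc zero)) x-away) (above zero))
      where
      above : ∀ i → v i ≤ x
      above i = *≤*-reverse (≤-trans x*≤y (y-away i))

    O-consistent : IsConsistent O
    O-consistent _ _ or os _ = O-strongly-consistent or os

    -- s lies above v i only, so by saturation s = v i.
    only-above : ∀ {s} i → v i ≤ s → s ≤ v (next i) * → s ≤ v (next (next i)) * → O s
    only-above i vi≤s p q = inj₁ (i , reflexive (saturated (record { above = vi≤s ; away = except i p q })))

    -- Once s is known to point away from or lie above each v i, count the v i below s.
    by-sides : ∀ {s} → s ≤ v zero * ⊎ v zero ≤ s → s ≤ v (suc zero) * ⊎ v (suc zero) ≤ s →
               s ≤ v (suc (suc zero)) * ⊎ v (suc (suc zero)) ≤ s → O s ⊎ O (s *)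
    by-sides (inj₁ a) (inj₁ b) (inj₁ c) = inj₁ (inj₂ (every a b c))
    by-sides (inj₂ a) (inj₁ b) (inj₁ c) = inj₁ (only-above zero a b c)
    by-sides (inj₁ a) (inj₂ b) (inj₁ c) = inj₁ (only-above (suc zero) b c a)
    by-sides (inj₁ a) (inj₁ b) (inj₂ c) = inj₁ (only-above (suc (suc zero)) c a b)
    by-sides (inj₁ a) (inj₂ b) (inj₂ c) =
      inj₂ (only-above zero (≤*-sym a) (order-reversing b) (order-reversing c))
    by-sides (inj₂ a) (inj₁ b) (inj₂ c) =
      inj₂ (only-above (suc zero) (≤*-sym b) (order-reversing c) (order-reversing a))
    by-sides (inj₂ a) (inj₂ b) (inj₁ c) =
      inj₂ (only-above (suc (suc zero)) (≤*-sym c) (order-reversing a) (order-reversing b))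
    by-sides (inj₂ a) (inj₂ b) (inj₂ c) =
      inj₂ (inj₂ (every (order-reversing a) (order-reversing b) (order-reversing c)))

    compare-with : ∀ s i → (O s ⊎ O (s *)) ⊎ (s ≤ v i * ⊎ v i ≤ s)
    compare-with s i with nested s (v i)
    ... | inj₁ s≤vi                 = inj₁ (inj₁ (inj₁ (i , s≤vi)))
    ... | inj₂ (inj₁ s≤vi*)         = inj₂ (inj₁ s≤vi*)
    ... | inj₂ (inj₂ (inj₁ s*≤vi))  = inj₁ (inj₂ (inj₁ (i , s*≤vi)))
    ... | inj₂ (inj₂ (inj₂ s*≤vi*)) = inj₂ (inj₂ (*≤*-reverse s*≤vi*))

    O-orientation : IsOrientation O
    O-orientation s = oriented , λ (os , os*) → O-strongly-consistent os os* ≤-refl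
      where
      oriented : O s ⊎ O (s *)
      oriented with compare-with s zero | compare-with s (suc zero) | compare-with s (suc (suc zero))
      ... | inj₁ settled | _            | _            = settled
      ... | _            | inj₁ settled | _            = settled
      ... | _            | _            | inj₁ settled = settled
      ... | inj₂ a       | inj₂ b       | inj₂ c       = by-sides a b c

    -- Above v i, O contains only v i: a larger v j is excluded by incomparability,
    -- a larger separation pointing away from all v j by saturation.
    v-maximal : ∀ i → MaximalIn O (v i)
    v-maximal i = inj₁ (i , ≤-refl) , above-vi
      where
      above-vi : ∀ y → O y → v i ≤ y → y ≡ v i
      above-vi y (inj₁ (j , y≤vj)) vi≤y =
        antisym (subst (λ k → y ≤ v k) (sym (incomparable (≤-trans vi≤y y≤vj))) y≤vj) vi≤y
      above-vi y (inj₂ y-away) vi≤y = saturated (away-region vi≤y y-away)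

    -- Every element of O lies below a maximal element of O: below v i, or below
    -- the greatest separation pointing away from all v i above it.
    below-maximal : ∀ x → O x → ∃ λ y → MaximalIn O y × x ≤ y
    below-maximal x (inj₁ (i , x≤vi)) = v i , v-maximal i , x≤vi
    below-maximal x (inj₂ x-away)     = m , (inj₂ m-away , m-maximal) , m-greatest x-away ≤-refl
      where
      away-sup-closed : SupClosed PointsAway
      away-sup-closed C C⊆A _ (_ , least) i = least (v i *) (λ y cy → C⊆A cy i)
      top : Σ S λ m → PointsAway m × (∀ {y} → PointsAway y → x ≤ y → y ≤ m)
      top = greatest-above (λ ax ay → O-strongly-consistent (inj₂ ax) (inj₂ ay)) away-sup-closed x-away
      m : S
      m = proj₁ top
      m-away : PointsAway m
      m-away = proj₁ (proj₂ top)
      m-greatest : ∀ {y} → PointsAway y → x ≤ y → y ≤ m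
      m-greatest = proj₂ (proj₂ top)
      m-maximal : ∀ y → O y → m ≤ y → y ≡ m
      m-maximal y (inj₂ y-away) m≤y =
        antisym (m-greatest y-away (≤-trans (m-greatest x-away ≤-refl) m≤y)) m≤y
      m-maximal y (inj₁ (i , y≤vi)) m≤y with below-both (≤-trans m≤y y≤vi) (m-away i)
      ... | inj₁ m≡vi  = antisym (subst (y ≤_) (sym m≡vi) y≤vi) m≤y
      ... | inj₂ m≡vi* = ⊥-elim (no-inverse-below (subst (_≤ v i) m≡vi* (≤-trans m≤y y≤vi)))

    σ' : Pred
    σ' = MaximalIn O

    σ'-branching : IsBranchingStar σ'
    σ'-branching =
      ( maximal-star O-orientation O-consistent
      , O , O-orientation , O-consistent , below-maximal , λ _ → mk⇔ id id)
      , v zero , v (suc zero) , v (suc (suc zero)) , v-maximal _ , v-maximal _ , v-maximal _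
      , distinct {zero} {suc zero} (λ ()) , distinct {zero} {suc (suc zero)} (λ ())
      , distinct {suc zero} {suc (suc zero)} (λ ())

    unique : ∀ {σ'' : Pred} {u : Fin 3 → S} → IsSplittingStar σ'' →
             (∀ i → σ'' (u i)) → (∀ i → u i ≤ v i) → SamePred σ'' σ'
    unique {σ''} {u} (_ , O'' , orient'' , consistent'' , below'' , σ''-max) u∈σ'' u≤v =
      maximal-transfer O''⊆O O⊆O'' σ''-max
      where
      u-maximal : ∀ i → MaximalIn O'' (u i)
      u-maximal i = Equivalence.to (σ''-max (u i)) (u∈σ'' i)

      -- If v i* were in O'', it would lie above u j ≤ v j for j ≠ i, hence equal u j.
      v∈O'' : ∀ i → O'' (v i)
      v∈O'' i with proj₁ (orient'' (v i))
      ... | inj₁ o  = o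
      ... | inj₂ o* = ⊥-elim (let (j , j≢i , _) = other i i
                                  vi*≡uj = proj₂ (u-maximal j) (v i *) o* (≤-trans (u≤v j) (star j≢i))
                              in no-inverse-below (subst (_≤ v j) (sym vi*≡uj) (u≤v j)))

      -- Since u i ≤ v i ∈ O'', maximality of u i gives v i = u i.
      v-maximal'' : ∀ i → MaximalIn O'' (v i)
      v-maximal'' i =
        v∈O'' i , λ y oy vi≤y → trans (proj₂ (u-maximal i) y oy (≤-trans (u≤v i) vi≤y)) (sym vi≡ui)
        where
        vi≡ui : v i ≡ u i
        vi≡ui = proj₂ (u-maximal i) (v i) (v∈O'' i) (u≤v i)

      -- An element y of σ'' with y* ∈ O would lie above some v i* or above all v i.
      σ''⊆O : ∀ {y} → σ'' y → O y
      σ''⊆O {y} σ''y with proj₁ (O-orientation y)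
      ... | inj₁ oy                 = oy
      ... | inj₂ (inj₁ (i , y*≤vi)) =
        let vi≡y = consistent-pointing orient'' consistent'' (v∈O'' i) oy (*≤-sym y*≤vi)
        in ⊥-elim (no-inverse-below (subst (v i * ≤_) (sym vi≡y) (*≤-sym y*≤vi)))
        where oy = proj₁ (Equivalence.to (σ''-max y) σ''y)
      ... | inj₂ (inj₂ y*-away)     =
        ⊥-elim (distinct {zero} {suc zero} (λ ()) (trans (sym (y≡v zero)) (y≡v (suc zero))))
        where
        y≡v : ∀ i → y ≡ v i
        y≡v i = proj₂ (v-maximal'' i) y (proj₁ (Equivalence.to (σ''-max y) σ''y)) (*≤*-reverse (y*-away i))

      O''⊆O : ∀ {x} → O'' x → O x
      O''⊆O {x} o''x = let (y , σ''y , x≤y) = below'' x o''x in O-down-closed x≤y (σ''⊆O σ''y)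

      O⊆O'' : ∀ {x} → O x → O'' x
      O⊆O'' = orientation-⊇ O-orientation orient'' O''⊆O

  record Enumeration (σ : Pred) (w : Fin 3 → S) : Set where
    field
      member    : ∀ i → σ (w i)
      locate    : ∀ {x} → σ x → Σ (Fin 3) λ i → x ≡ w i
      injective : ∀ {i j} → w i ≡ w j → i ≡ j

  enumerate : ∀ {σ : Pred} → ExactlyThree σ → Σ (Fin 3 → S) (Enumeration σ)
  enumerate {σ} (a , b , c , a≢b , a≢c , b≢c , σ⇔abc) =
    w , record { member = member ; locate = locate ; injective = injective }
    where
    w : Fin 3 → S
    w zero             = a
    w (suc zero)       = b
    w (suc (suc zero)) = c

    member : ∀ i → σ (w i)
    member zero             = Equivalence.from (σ⇔abc a) (inj₁ refl)
    member (suc zero)       = Equivalence.from (σ⇔abc b) (inj₂ (inj₁ refl))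
    member (suc (suc zero)) = Equivalence.from (σ⇔abc c) (inj₂ (inj₂ refl))

    index : ∀ {x} → (x ≡ a) ⊎ (x ≡ b) ⊎ (x ≡ c) → Σ (Fin 3) λ i → x ≡ w i
    index (inj₁ x≡a)        = zero , x≡a
    index (inj₂ (inj₁ x≡b)) = suc zero , x≡b
    index (inj₂ (inj₂ x≡c)) = suc (suc zero) , x≡c

    locate : ∀ {x} → σ x → Σ (Fin 3) λ i → x ≡ w i
    locate {x} σx = index (Equivalence.to (σ⇔abc x) σx)

    injective : ∀ {i j} → w i ≡ w j → i ≡ j
    injective {zero}             {zero}             _ = refl
    injective {zero}             {suc zero}         e = ⊥-elim (a≢b e)
    injective {zero}             {suc (suc zero)}   e = ⊥-elim (a≢c e)
    injective {suc zero}         {zero}             e = ⊥-elim (a≢b (sym e))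
    injective {suc zero}         {suc zero}         _ = refl
    injective {suc zero}         {suc (suc zero)}   e = ⊥-elim (b≢c e)
    injective {suc (suc zero)}   {zero}             e = ⊥-elim (a≢c (sym e))
    injective {suc (suc zero)}   {suc zero}         e = ⊥-elim (b≢c (sym e))
    injective {suc (suc zero)}   {suc (suc zero)}   _ = refl

  enumeration-three-star : ∀ {σ : Pred} {w : Fin 3 → S} → IsStar σ → Enumeration σ w → ThreeStar w
  enumeration-three-star {σ} {w} σ-star E = record
    { star      = λ i≢j → σ-star _ _ (member _) (member _) (λ e → i≢j (injective e))
    ; injective = injective
    }
    where open Enumeration E

  lies-below-distinct : ∀ {σ σ' : Pred} {w v : Fin 3 → S} → Enumeration σ w →
                        (∀ i → σ' (v i)) → (∀ i → w i ≤ v i) → (∀ {i j} → v i ≡ v j → i ≡ j) →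
                        LiesBelowDistinct σ σ'
  lies-below-distinct {σ} {w = w} {v} E v∈σ' w≤v v-injective =
      (λ _ p → v (index p))
    , (λ _ p → v∈σ' (index p) , subst (_≤ v (index p)) (sym (at-index p)) (w≤v (index p)))
    , λ _ _ p q vp≡vq →
        trans (at-index p) (trans (cong w (v-injective {index p} {index q} vp≡vq)) (sym (at-index q)))
    where
    open Enumeration E
    index : ∀ {x} → σ x → Fin 3
    index p = proj₁ (locate p)
    at-index : ∀ {x} (p : σ x) → x ≡ w (index p)
    at-index p = proj₂ (locate p)

  candidates-in-regions : ∀ {σ σ'' : Pred} {w : Fin 3 → S} →
                          IsStar σ'' → Enumeration σ w → LiesBelowDistinct σ σ'' →
                          Σ (Fin 3 → S) λ u → (∀ i → σ'' (u i)) × (∀ i → Region w i (u i))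
  candidates-in-regions {σ'' = σ''} {w = w} σ''-star E (f , f-above , f-injective) = u , u∈σ'' , u-region
    where
    open Enumeration E
    u : Fin 3 → S
    u i = f (w i) (member i)
    u∈σ'' : ∀ i → σ'' (u i)
    u∈σ'' i = proj₁ (f-above (w i) (member i))
    w≤u : ∀ i → w i ≤ u i
    w≤u i = proj₂ (f-above (w i) (member i))
    u-region : ∀ i → Region w i (u i)
    u-region i = record
      { above = w≤u i
      ; away  = λ {j} j≢i → ≤-trans (σ''-star (u i) (u j) (u∈σ'' i) (u∈σ'' j)
                                       (λ e → j≢i (sym (injective (f-injective _ _ _ _ e)))))
                                    (order-reversing (w≤u j))
      }

proposition3p9 : ExcludedMiddle 0ℓ → (τ : SeparationSystem) →
    let open SeparationSystem τ in
    IsTreeSet → ChainComplete → (σ : Pred) → IsStar σ → ExactlyThree σ →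
    Σ Pred λ σ' → (IsBranchingStar σ' × LiesBelowDistinct σ σ')
    × (∀ σ'' → IsBranchingStar σ'' → LiesBelowDistinct σ σ'' → SamePred σ'' σ')
proposition3p9 em τ tree complete σ σ-star three =
  σ' , (σ'-branching , lies-below) , uniqueness
  where
  open SeparationSystem τ
  open TreeSets em τ tree complete
  w : Fin 3 → S
  w = proj₁ (enumerate three)
  E : Enumeration σ w
  E = proj₂ (enumerate three)
  open Saturation (enumeration-three-star σ-star E)
  open Orientation v-three-star v-saturated
  lies-below : LiesBelowDistinct σ σ'
  lies-below = lies-below-distinct {σ' = σ'} {v = v} E v-maximal w≤v
                 λ {i} {j} → ThreeStar.injective v-three-star {i} {j}
  uniqueness : ∀ σ'' → IsBranchingStar σ'' → LiesBelowDistinct σ σ'' → SamePred σ'' σ'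
  uniqueness σ'' (splitting , _) below with candidates-in-regions (proj₁ splitting) E below
  ... | u , u∈σ'' , u-region = unique {u = u} splitting u∈σ'' (λ i → v-greatest (u-region i))
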